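{- For all integers $n\geq0$, \[ \sum_{j=0}^n\binom{2j}{j}\binom{2(n-j)}{n-j}O_jO_{n-j} = 4^{n-1}\sum_{j=1}^n\frac{H_{n-j}}{j}. \]
   Context: $H_n=\sum_{j=1}^n \frac1j$ (with $H_0=0$) and $O_n=\sum_{j=1}^n\frac{1}{2j-1}$ (with $O_0=0$). -}

module Defs where

open import Data.Nat as ℕ using (ℕ; zero; suc; _∸_)
open import Data.Nat.Combinatorics using (_C_)
open import Data.Integer using (+_)
open import Data.Rational using (ℚ; 0ℚ; 1ℚ; _+_; _*_; _/_)

toℚ : ℕ → ℚ
toℚ k = (+ k) / 1

sum1 : ℕ → (ℕ → ℚ) → ℚ
sum1 zero    f = 0ℚ
sum1 (suc n) f = sum1 n f + f (suc n)

sum0 : ℕ → (ℕ → ℚ) → ℚ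
sum0 zero    f = f 0
sum0 (suc n) f = sum0 n f + f (suc n)

-- 1/j for j ≥ 1 (only ever used at j ≥ 1; value at 0 is irrelevant)
recip : ℕ → ℚ
recip zero    = 0ℚ
recip (suc k) = (+ 1) / suc k

H : ℕ → ℚ
H n = sum1 n recip

O : ℕ → ℚ
O n = sum1 n oddRecip
  where
  oddRecip : ℕ → ℚ
  oddRecip zero    = 0ℚ
  oddRecip (suc k) = (+ 1) / suc (2 ℕ.* k)

-- 4^(n-1) as a rational number (equals 1/4 when n = 0)
pow4m1 : ℕ → ℚ
pow4m1 n = ((+ 1) / 4) * toℚ (4 ℕ.^ n)

cbin : ℕ → ℚ
cbin j = toℚ ((2 ℕ.* j) C j)

-- Read sequences as coefficients of formal power series, with _⋆_ their product. Then
-- cbin = (1 − 4x)^(−1/2), and the left-hand side is the coefficient of xⁿ in b², where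
-- b = Σ C(2j,j) O_j x^j. A linear equation (1 − αx) y′ = βy + v has at most one solution with given
-- y(0), and a product of two solutions solves another such equation. This gives cbin² = (1 − 4x)⁻¹,
-- and, via (n+1) C(2n+2,n+1) = 2(2n+1) C(2n,n), it gives b = cbin · ½ log(1/(1 − 4x)), since both
-- solve (1 − 4x) y′ = 2y + 2 cbin with y(0) = 0. Hence b² = (1 − 4x)⁻¹ · ¼ log²(1/(1 − 4x)), whose
-- n-th coefficient is ¼ · 4ⁿ · Σ_j H_{n−j}/j because (1 − y)⁻¹ log(1/(1 − y)) = Σ H_n yⁿ.
module Submission where

module Binomial where
  open import Data.Nat
  import Data.Nat.Properties as ℕP
  open import Data.Nat.Combinatorics
  open import Data.Nat.Solver using (module +-*-Solver)
  open import Relation.Binary.PropositionalEquality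

  [k+1]*[n+1]C[k+1]≡[n+1]*nCk : ∀ n k → suc k * (suc n C suc k) ≡ suc n * (n C k)
  [k+1]*[n+1]C[k+1]≡[n+1]*nCk zero    zero    = refl
  [k+1]*[n+1]C[k+1]≡[n+1]*nCk zero    (suc k) = ℕP.*-zeroʳ (suc (suc k))
  [k+1]*[n+1]C[k+1]≡[n+1]*nCk (suc n) zero    =
    trans (ℕP.*-identityˡ _) (trans (nC1≡n (suc (suc n))) (sym (ℕP.*-identityʳ _)))
  [k+1]*[n+1]C[k+1]≡[n+1]*nCk (suc n) (suc k) = begin
    suc (suc k) * (suc (suc n) C suc (suc k))
      ≡⟨ cong (suc (suc k) *_) (nCk+nC[k+1]≡[n+1]C[k+1] (suc n) (suc k)) ⟨
    suc (suc k) * (A + B)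
      ≡⟨ solve 3 (λ k A B → (con 2 :+ k) :* (A :+ B) := ((con 1 :+ k) :* A :+ A) :+ (con 2 :+ k) :* B) refl k A B ⟩
    (suc k * A + A) + suc (suc k) * B
      ≡⟨ cong₂ (λ u v → (u + A) + v) ([k+1]*[n+1]C[k+1]≡[n+1]*nCk n k)
                                     ([k+1]*[n+1]C[k+1]≡[n+1]*nCk n (suc k)) ⟩
    (suc n * (n C k) + A) + suc n * (n C suc k)
      ≡⟨ solve 4 (λ n c d A → (n :* c :+ A) :+ n :* d := n :* (c :+ d) :+ A) refl (suc n) (n C k) (n C suc k) A ⟩
    suc n * (n C k + n C suc k) + A
      ≡⟨ cong (λ u → suc n * u + A) (nCk+nC[k+1]≡[n+1]C[k+1] n k) ⟩
    suc n * A + A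
      ≡⟨ ℕP.+-comm (suc n * A) A ⟩
    suc (suc n) * A ∎
    where
    open ≡-Reasoning
    open +-*-Solver
    A B : ℕ
    A = suc n C suc k
    B = suc n C suc (suc k)

  [n+1]*[2n+2]C[n+1]≡2*[2n+1]*[2n]Cn : ∀ n →
    suc n * ((2 * suc n) C suc n) ≡ 2 * suc (2 * n) * ((2 * n) C n)
  [n+1]*[2n+2]C[n+1]≡2*[2n+1]*[2n]Cn n = begin
    suc n * ((2 * suc n) C suc n)    ≡⟨ cong (λ m → suc n * (m C suc n)) (ℕP.*-suc 2 n) ⟩
    suc n * (suc (suc t) C suc n)    ≡⟨ [k+1]*[n+1]C[k+1]≡[n+1]*nCk (suc t) n ⟩
    suc (suc t) * (suc t C n)        ≡⟨ cong (suc (suc t) *_) symmetric ⟨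
    suc (suc t) * (suc t C suc n)    ≡⟨ cong (_* (suc t C suc n)) (ℕP.*-suc 2 n) ⟨
    2 * suc n * (suc t C suc n)      ≡⟨ ℕP.*-assoc 2 (suc n) _ ⟩
    2 * (suc n * (suc t C suc n))    ≡⟨ cong (2 *_) ([k+1]*[n+1]C[k+1]≡[n+1]*nCk t n) ⟩
    2 * (suc t * (t C n))            ≡⟨ ℕP.*-assoc 2 (suc t) _ ⟨
    2 * suc t * (t C n)              ∎
    where
    open ≡-Reasoning
    t : ℕ
    t = 2 * n
    symmetric : suc t C suc n ≡ suc t C n
    symmetric = trans (nCk≡nC[n∸k] (s≤s (ℕP.m≤m+n n (n + 0))))
                      (cong (suc t C_) (trans (ℕP.m+n∸m≡n n (n + 0)) (ℕP.+-identityʳ n)))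


open import Data.Nat as ℕ using (ℕ; zero; suc; _∸_; z≤n)
import Data.Nat.Properties as ℕP
import Data.Integer as ℤ
import Data.Integer.Properties as ℤP
import Data.Nat.Coprimality as Coprime
open import Data.Rational using (ℚ; mkℚ; 0ℚ; 1ℚ; ½; 1/_; _+_; _*_)
open import Data.Rational.Properties
import Data.Rational.Unnormalised as ℚᵘ
import Data.Rational.Unnormalised.Properties as ℚᵘP
open import Data.Rational.Solver using (module +-*-Solver)
open Binomial using ([n+1]*[2n+2]C[n+1]≡2*[2n+1]*[2n]Cn)
open import Data.Nat.Combinatorics using (_C_)
open import Function using (_∘_)
open import Relation.Binary.PropositionalEquality
open import Defs

open +-*-Solver
open ≡-Reasoning

-- The normal form of toℚ k, on which toℚᵘ and 1/_ compute.
integral : ℕ → ℚ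
integral k = mkℚ (ℤ.+ k) 0 (Coprime.sym (Coprime.1-coprimeTo k))

toℚ≡integral : ∀ k → toℚ k ≡ integral k
toℚ≡integral k = ↥p/↧p≡p (integral k)

toℚ-suc : ∀ k → toℚ (suc k) ≡ 1ℚ + toℚ k
toℚ-suc k = begin
  toℚ (suc k)      ≡⟨ toℚ≡integral (suc k) ⟩
  integral (suc k) ≡⟨ toℚᵘ-injective (ℚᵘP.≃-sym (ℚᵘP.≃-trans (toℚᵘ-homo-+ 1ℚ (integral k))
                                                              (ℚᵘ.*≡* ℤ-identity))) ⟩
  1ℚ + integral k  ≡⟨ cong (1ℚ +_) (toℚ≡integral k) ⟨
  1ℚ + toℚ k       ∎
  where
  ℤ-identity : (ℤ.1ℤ ℤ.* ℤ.1ℤ ℤ.+ ℤ.+ k ℤ.* ℤ.1ℤ) ℤ.* ℤ.1ℤ ≡ ℤ.+ suc k ℤ.* (ℤ.1ℤ ℤ.* ℤ.1ℤ)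
  ℤ-identity = trans (ℤP.*-identityʳ _)
                 (trans (cong (ℤ._+_ ℤ.1ℤ) (ℤP.*-identityʳ (ℤ.+ k))) (sym (ℤP.*-identityʳ _)))

toℚ-+ : ∀ m n → toℚ (m ℕ.+ n) ≡ toℚ m + toℚ n
toℚ-+ zero    n = sym (+-identityˡ (toℚ n))
toℚ-+ (suc m) n = begin
  toℚ (suc m ℕ.+ n)        ≡⟨ toℚ-suc (m ℕ.+ n) ⟩
  1ℚ + toℚ (m ℕ.+ n)       ≡⟨ cong (1ℚ +_) (toℚ-+ m n) ⟩
  1ℚ + (toℚ m + toℚ n)     ≡⟨ +-assoc 1ℚ (toℚ m) (toℚ n) ⟨
  (1ℚ + toℚ m) + toℚ n     ≡⟨ cong (_+ toℚ n) (toℚ-suc m) ⟨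
  toℚ (suc m) + toℚ n      ∎

toℚ-* : ∀ m n → toℚ (m ℕ.* n) ≡ toℚ m * toℚ n
toℚ-* zero    n = sym (*-zeroˡ (toℚ n))
toℚ-* (suc m) n = begin
  toℚ (n ℕ.+ m ℕ.* n)      ≡⟨ toℚ-+ n (m ℕ.* n) ⟩
  toℚ n + toℚ (m ℕ.* n)    ≡⟨ cong (toℚ n +_) (toℚ-* m n) ⟩
  toℚ n + toℚ m * toℚ n    ≡⟨ solve 2 (λ a b → a :+ b :* a := (con 1ℚ :+ b) :* a) refl (toℚ n) (toℚ m) ⟩
  (1ℚ + toℚ m) * toℚ n     ≡⟨ cong (_* toℚ n) (toℚ-suc m) ⟨
  toℚ (suc m) * toℚ n      ∎

toℚ-*-recip : ∀ k → toℚ (suc k) * recip (suc k) ≡ 1ℚ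
toℚ-*-recip k = begin
  toℚ (suc k) * recip (suc k)
    ≡⟨ cong₂ _*_ (toℚ≡integral (suc k)) (↥p/↧p≡p (1/ integral (suc k))) ⟩
  integral (suc k) * 1/ integral (suc k)
    ≡⟨ *-inverseʳ (integral (suc k)) ⟩
  1ℚ ∎

toℚ-suc-*-cancelˡ : ∀ k {x y} → toℚ (suc k) * x ≡ toℚ (suc k) * y → x ≡ y
toℚ-suc-*-cancelˡ k {x} {y} eq = begin
  x                ≡⟨ *-identityˡ x ⟨
  1ℚ * x           ≡⟨ cong (_* x) (toℚ-*-recip k) ⟨
  t * r * x        ≡⟨ solve 3 (λ t r x → t :* r :* x := r :* (t :* x)) refl t r x ⟩
  r * (t * x)      ≡⟨ cong (r *_) eq ⟩
  r * (t * y)      ≡⟨ solve 3 (λ t r y → r :* (t :* y) := t :* r :* y) refl t r y ⟩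
  t * r * y        ≡⟨ cong (_* y) (toℚ-*-recip k) ⟩
  1ℚ * y           ≡⟨ *-identityˡ y ⟩
  y                ∎
  where
  t r : ℚ
  t = toℚ (suc k)
  r = recip (suc k)

Series : Set
Series = ℕ → ℚ

sum0-cong : ∀ n {f g : Series} → (∀ j → f j ≡ g j) → sum0 n f ≡ sum0 n g
sum0-cong zero    f≗g = f≗g 0
sum0-cong (suc n) f≗g = cong₂ _+_ (sum0-cong n f≗g) (f≗g (suc n))

sum0-cong-≤ : ∀ n {f g : Series} → (∀ j → j ℕ.≤ n → f j ≡ g j) → sum0 n f ≡ sum0 n g
sum0-cong-≤ zero    f≗g = f≗g 0 z≤n
sum0-cong-≤ (suc n) f≗g =
  cong₂ _+_ (sum0-cong-≤ n (λ j j≤n → f≗g j (ℕP.m≤n⇒m≤1+n j≤n))) (f≗g (suc n) ℕP.≤-refl)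

sum1-cong : ∀ n {f g : Series} → (∀ j → f j ≡ g j) → sum1 n f ≡ sum1 n g
sum1-cong zero    f≗g = refl
sum1-cong (suc n) f≗g = cong₂ _+_ (sum1-cong n f≗g) (f≗g (suc n))

sum0-+ : ∀ n (f g : Series) → sum0 n (λ j → f j + g j) ≡ sum0 n f + sum0 n g
sum0-+ zero    f g = refl
sum0-+ (suc n) f g = trans (cong (_+ (f (suc n) + g (suc n))) (sum0-+ n f g))
  (solve 4 (λ a b c d → (a :+ b) :+ (c :+ d) := (a :+ c) :+ (b :+ d)) refl (sum0 n f) (sum0 n g) (f (suc n)) (g (suc n)))

sum0-*ˡ : ∀ n a (f : Series) → sum0 n (λ j → a * f j) ≡ a * sum0 n f
sum0-*ˡ zero    a f = refl
sum0-*ˡ (suc n) a f = trans (cong (_+ a * f (suc n)) (sum0-*ˡ n a f)) (sym (*-distribˡ-+ a (sum0 n f) (f (suc n))))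

sum0-suc : ∀ n (f : Series) → sum0 (suc n) f ≡ f 0 + sum0 n (f ∘ suc)
sum0-suc zero    f = refl
sum0-suc (suc n) f = trans (cong (_+ f (suc (suc n))) (sum0-suc n f)) (+-assoc (f 0) _ _)

sum0-reverse : ∀ n (f : Series) → sum0 n f ≡ sum0 n (λ j → f (n ∸ j))
sum0-reverse zero    f = refl
sum0-reverse (suc n) f = begin
  sum0 n f + f (suc n)                              ≡⟨ +-comm (sum0 n f) (f (suc n)) ⟩
  f (suc n) + sum0 n f                              ≡⟨ cong (f (suc n) +_) (sum0-reverse n f) ⟩
  f (suc n) + sum0 n (λ j → f (n ∸ j))              ≡⟨ sum0-suc n (λ j → f (suc n ∸ j)) ⟨
  sum0 (suc n) (λ j → f (suc n ∸ j))                ∎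

sum0≡f0+sum1 : ∀ n (f : Series) → sum0 n f ≡ f 0 + sum1 n f
sum0≡f0+sum1 zero    f = sym (+-identityʳ (f 0))
sum0≡f0+sum1 (suc n) f = trans (cong (_+ f (suc n)) (sum0≡f0+sum1 n f)) (+-assoc (f 0) _ _)

infixl 7 _⋆_

_⋆_ : Series → Series → Series
(f ⋆ g) n = sum0 n (λ j → f j * g (n ∸ j))

⋆-cong : ∀ {f f′ g g′ : Series} → (∀ j → f j ≡ f′ j) → (∀ j → g j ≡ g′ j) →
         ∀ n → (f ⋆ g) n ≡ (f′ ⋆ g′) n
⋆-cong f≗f′ g≗g′ n = sum0-cong n (λ j → cong₂ _*_ (f≗f′ j) (g≗g′ (n ∸ j)))

⋆-congˡ : ∀ {f f′ : Series} g → (∀ j → f j ≡ f′ j) → ∀ n → (f ⋆ g) n ≡ (f′ ⋆ g) n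
⋆-congˡ g f≗f′ = ⋆-cong f≗f′ (λ j → refl {x = g j})

⋆-congʳ : ∀ f {g g′ : Series} → (∀ j → g j ≡ g′ j) → ∀ n → (f ⋆ g) n ≡ (f ⋆ g′) n
⋆-congʳ f g≗g′ = ⋆-cong (λ j → refl {x = f j}) g≗g′

⋆-comm : ∀ f g n → (f ⋆ g) n ≡ (g ⋆ f) n
⋆-comm f g n = trans (sum0-reverse n (λ j → f j * g (n ∸ j)))
  (sum0-cong-≤ n (λ j j≤n → trans (cong (λ m → f (n ∸ j) * g m) (ℕP.m∸[m∸n]≡n j≤n))
                                  (*-comm (f (n ∸ j)) (g j))))

⋆-suc : ∀ f g n → (f ⋆ g) (suc n) ≡ f 0 * g (suc n) + ((f ∘ suc) ⋆ g) n
⋆-suc f g n = sum0-suc n (λ j → f j * g (suc n ∸ j))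

⋆-distribʳ-+ : ∀ f g h n → ((λ j → f j + g j) ⋆ h) n ≡ (f ⋆ h) n + (g ⋆ h) n
⋆-distribʳ-+ f g h n = trans (sum0-cong n (λ j → *-distribʳ-+ (h (n ∸ j)) (f j) (g j))) (sum0-+ n _ _)

⋆-*ˡ : ∀ a f g n → ((λ j → a * f j) ⋆ g) n ≡ a * (f ⋆ g) n
⋆-*ˡ a f g n = trans (sum0-cong n (λ j → *-assoc a (f j) (g (n ∸ j)))) (sum0-*ˡ n a _)

⋆-*ʳ : ∀ a f g n → (f ⋆ (λ j → a * g j)) n ≡ a * (f ⋆ g) n
⋆-*ʳ a f g n = trans (⋆-comm f (λ j → a * g j) n) (trans (⋆-*ˡ a g f n) (cong (a *_) (⋆-comm g f n)))

⋆-zeroˡ : ∀ f n → ((λ _ → 0ℚ) ⋆ f) n ≡ 0ℚ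
⋆-zeroˡ f n = trans (sum0-*ˡ n 0ℚ (λ j → f (n ∸ j))) (*-zeroˡ (sum0 n (λ j → f (n ∸ j))))

scalar : ℚ → Series
scalar a zero    = a
scalar a (suc _) = 0ℚ

⋆-scalarˡ : ∀ a f n → (scalar a ⋆ f) n ≡ a * f n
⋆-scalarˡ a f zero    = refl
⋆-scalarˡ a f (suc n) = begin
  (scalar a ⋆ f) (suc n)                           ≡⟨ ⋆-suc (scalar a) f n ⟩
  a * f (suc n) + ((λ _ → 0ℚ) ⋆ f) n               ≡⟨ cong (a * f (suc n) +_) (⋆-zeroˡ f n) ⟩
  a * f (suc n) + 0ℚ                               ≡⟨ +-identityʳ _ ⟩
  a * f (suc n)                                    ∎

⋆-assoc : ∀ f g h n → ((f ⋆ g) ⋆ h) n ≡ (f ⋆ (g ⋆ h)) n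
⋆-assoc f g h zero    = *-assoc (f 0) (g 0) (h 0)
⋆-assoc f g h (suc n) = begin
  ((f ⋆ g) ⋆ h) (suc n)
    ≡⟨ ⋆-suc (f ⋆ g) h n ⟩
  f 0 * g 0 * h (suc n) + (((f ⋆ g) ∘ suc) ⋆ h) n
    ≡⟨ cong (f 0 * g 0 * h (suc n) +_) (⋆-congˡ h (⋆-suc f g) n) ⟩
  f 0 * g 0 * h (suc n) + ((λ m → f 0 * g (suc m) + ((f ∘ suc) ⋆ g) m) ⋆ h) n
    ≡⟨ cong (f 0 * g 0 * h (suc n) +_) (⋆-distribʳ-+ (λ m → f 0 * g (suc m)) ((f ∘ suc) ⋆ g) h n) ⟩
  f 0 * g 0 * h (suc n) + (((λ m → f 0 * g (suc m)) ⋆ h) n + (((f ∘ suc) ⋆ g) ⋆ h) n)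
    ≡⟨ cong₂ (λ u v → f 0 * g 0 * h (suc n) + (u + v))
             (⋆-*ˡ (f 0) (g ∘ suc) h n) (⋆-assoc (f ∘ suc) g h n) ⟩
  f 0 * g 0 * h (suc n) + (f 0 * ((g ∘ suc) ⋆ h) n + ((f ∘ suc) ⋆ (g ⋆ h)) n)
    ≡⟨ solve 5 (λ a b c x y → a :* b :* c :+ (a :* x :+ y) := a :* (b :* c :+ x) :+ y) refl
         (f 0) (g 0) (h (suc n)) (((g ∘ suc) ⋆ h) n) (((f ∘ suc) ⋆ (g ⋆ h)) n) ⟩
  f 0 * (g 0 * h (suc n) + ((g ∘ suc) ⋆ h) n) + ((f ∘ suc) ⋆ (g ⋆ h)) n
    ≡⟨ cong (λ u → f 0 * u + ((f ∘ suc) ⋆ (g ⋆ h)) n) (⋆-suc g h n) ⟨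
  f 0 * (g ⋆ h) (suc n) + ((f ∘ suc) ⋆ (g ⋆ h)) n
    ≡⟨ ⋆-suc f (g ⋆ h) n ⟨
  (f ⋆ (g ⋆ h)) (suc n) ∎

⋆-interchange : ∀ f g h k n → ((f ⋆ g) ⋆ (h ⋆ k)) n ≡ ((f ⋆ h) ⋆ (g ⋆ k)) n
⋆-interchange f g h k n = begin
  ((f ⋆ g) ⋆ (h ⋆ k)) n    ≡⟨ ⋆-assoc f g (h ⋆ k) n ⟩
  (f ⋆ (g ⋆ (h ⋆ k))) n    ≡⟨ ⋆-congʳ f middle n ⟩
  (f ⋆ (h ⋆ (g ⋆ k))) n    ≡⟨ ⋆-assoc f h (g ⋆ k) n ⟨
  ((f ⋆ h) ⋆ (g ⋆ k)) n    ∎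
  where
  middle : ∀ m → (g ⋆ (h ⋆ k)) m ≡ (h ⋆ (g ⋆ k)) m
  middle m = begin
    (g ⋆ (h ⋆ k)) m        ≡⟨ ⋆-assoc g h k m ⟨
    ((g ⋆ h) ⋆ k) m        ≡⟨ ⋆-congˡ k (⋆-comm g h) m ⟩
    ((h ⋆ g) ⋆ k) m        ≡⟨ ⋆-assoc h g k m ⟩
    (h ⋆ (g ⋆ k)) m        ∎

θ : Series → Series
θ f n = toℚ n * f n

∂ : Series → Series
∂ f n = toℚ (suc n) * f (suc n)

θ-⋆ : ∀ f g n → θ (f ⋆ g) n ≡ (θ f ⋆ g) n + (θ g ⋆ f) n
θ-⋆ f g n = begin
  toℚ n * (f ⋆ g) n                  ≡⟨ sum0-*ˡ n (toℚ n) (λ j → f j * g (n ∸ j)) ⟨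
  sum0 n (λ j → toℚ n * (f j * g (n ∸ j)))
    ≡⟨ sum0-cong-≤ n split ⟩
  sum0 n (λ j → θ f j * g (n ∸ j) + f j * θ g (n ∸ j))
    ≡⟨ sum0-+ n (λ j → θ f j * g (n ∸ j)) (λ j → f j * θ g (n ∸ j)) ⟩
  (θ f ⋆ g) n + (f ⋆ θ g) n          ≡⟨ cong ((θ f ⋆ g) n +_) (⋆-comm f (θ g) n) ⟩
  (θ f ⋆ g) n + (θ g ⋆ f) n          ∎
  where
  split : ∀ j → j ℕ.≤ n → toℚ n * (f j * g (n ∸ j)) ≡ θ f j * g (n ∸ j) + f j * θ g (n ∸ j)
  split j j≤n = begin
    toℚ n * (f j * g (n ∸ j))
      ≡⟨ cong (λ m → toℚ m * (f j * g (n ∸ j))) (ℕP.m+[n∸m]≡n j≤n) ⟨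
    toℚ (j ℕ.+ (n ∸ j)) * (f j * g (n ∸ j))
      ≡⟨ cong (_* (f j * g (n ∸ j))) (toℚ-+ j (n ∸ j)) ⟩
    (toℚ j + toℚ (n ∸ j)) * (f j * g (n ∸ j))
      ≡⟨ solve 4 (λ a b x y → (a :+ b) :* (x :* y) := a :* x :* y :+ x :* (b :* y)) refl
           (toℚ j) (toℚ (n ∸ j)) (f j) (g (n ∸ j)) ⟩
    θ f j * g (n ∸ j) + f j * θ g (n ∸ j) ∎

θ⋆-suc : ∀ f g n → (θ f ⋆ g) (suc n) ≡ (∂ f ⋆ g) n
θ⋆-suc f g n = begin
  (θ f ⋆ g) (suc n)                      ≡⟨ ⋆-suc (θ f) g n ⟩
  0ℚ * f 0 * g (suc n) + (∂ f ⋆ g) n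
    ≡⟨ solve 3 (λ x y z → con 0ℚ :* x :* y :+ z := z) refl (f 0) (g (suc n)) ((∂ f ⋆ g) n) ⟩
  (∂ f ⋆ g) n                            ∎

∂-⋆ : ∀ f g n → ∂ (f ⋆ g) n ≡ (∂ f ⋆ g) n + (∂ g ⋆ f) n
∂-⋆ f g n = trans (θ-⋆ f g (suc n)) (cong₂ _+_ (θ⋆-suc f g n) (θ⋆-suc g f n))

dilate : ℕ → Series → Series
dilate r f n = toℚ (r ℕ.^ n) * f n

⋆-dilate : ∀ r f g n → (dilate r f ⋆ dilate r g) n ≡ dilate r (f ⋆ g) n
⋆-dilate r f g n = trans (sum0-cong-≤ n regroup) (sum0-*ˡ n (toℚ (r ℕ.^ n)) (λ j → f j * g (n ∸ j)))
  where
  regroup : ∀ j → j ℕ.≤ n → dilate r f j * dilate r g (n ∸ j) ≡ toℚ (r ℕ.^ n) * (f j * g (n ∸ j))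
  regroup j j≤n = begin
    toℚ (r ℕ.^ j) * f j * (toℚ (r ℕ.^ (n ∸ j)) * g (n ∸ j))
      ≡⟨ solve 4 (λ p x q y → p :* x :* (q :* y) := p :* q :* (x :* y)) refl
           (toℚ (r ℕ.^ j)) (f j) (toℚ (r ℕ.^ (n ∸ j))) (g (n ∸ j)) ⟩
    toℚ (r ℕ.^ j) * toℚ (r ℕ.^ (n ∸ j)) * (f j * g (n ∸ j))
      ≡⟨ cong (_* (f j * g (n ∸ j))) (toℚ-* (r ℕ.^ j) (r ℕ.^ (n ∸ j))) ⟨
    toℚ (r ℕ.^ j ℕ.* r ℕ.^ (n ∸ j)) * (f j * g (n ∸ j))
      ≡⟨ cong (λ m → toℚ m * (f j * g (n ∸ j))) (ℕP.^-distribˡ-+-* r j (n ∸ j)) ⟨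
    toℚ (r ℕ.^ (j ℕ.+ (n ∸ j))) * (f j * g (n ∸ j))
      ≡⟨ cong (λ m → toℚ (r ℕ.^ m) * (f j * g (n ∸ j))) (ℕP.m+[n∸m]≡n j≤n) ⟩
    toℚ (r ℕ.^ n) * (f j * g (n ∸ j)) ∎

-- The j = 0 term drops out because recip 0 = 0.
⋆-recip : ∀ f n → (f ⋆ recip) n ≡ sum1 n (λ j → f (n ∸ j) * recip j)
⋆-recip f n = begin
  (f ⋆ recip) n                                  ≡⟨ ⋆-comm f recip n ⟩
  (recip ⋆ f) n                                  ≡⟨ sum0≡f0+sum1 n (λ j → recip j * f (n ∸ j)) ⟩
  0ℚ * f n + sum1 n (λ j → recip j * f (n ∸ j))
    ≡⟨ solve 2 (λ x s → con 0ℚ :* x :+ s := s) refl (f n) (sum1 n (λ j → recip j * f (n ∸ j))) ⟩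
  sum1 n (λ j → recip j * f (n ∸ j))             ≡⟨ sum1-cong n (λ j → *-comm (recip j) (f (n ∸ j))) ⟩
  sum1 n (λ j → f (n ∸ j) * recip j)             ∎

-- The coefficientwise form of (1 − αx) f′ = β f + v.
record IsSolution (α β : ℚ) (v f : Series) : Set where
  constructor isSolution
  field equation : ∀ n → ∂ f n ≡ α * θ f n + β * f n + v n

open IsSolution

solution-unique : ∀ {α β v w f g} → IsSolution α β v f → IsSolution α β w g →
                  (∀ n → v n ≡ w n) → f 0 ≡ g 0 → ∀ n → f n ≡ g n
solution-unique             sf sg v≗w f0≡g0 zero    = f0≡g0
solution-unique {α} {β} {v} {w} {f} {g} sf sg v≗w f0≡g0 (suc n) =
  toℚ-suc-*-cancelˡ n (begin
  ∂ f n                                  ≡⟨ equation sf n ⟩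
  α * (toℚ n * f n) + β * f n + v n      ≡⟨ cong₂ (λ x y → α * (toℚ n * x) + β * x + y) fn≡gn (v≗w n) ⟩
  α * (toℚ n * g n) + β * g n + w n      ≡⟨ equation sg n ⟨
  ∂ g n                                  ∎)
  where
  fn≡gn : f n ≡ g n
  fn≡gn = solution-unique sf sg v≗w f0≡g0 n

IsSolution-⋆ : ∀ {α β γ v w f g} → IsSolution α β v f → IsSolution α γ w g →
               IsSolution α (β + γ) (λ n → (v ⋆ g) n + (w ⋆ f) n) (f ⋆ g)
IsSolution-⋆ {α} {β} {γ} {v} {w} {f} {g} sf sg = isSolution λ n → begin
  ∂ (f ⋆ g) n
    ≡⟨ ∂-⋆ f g n ⟩
  (∂ f ⋆ g) n + (∂ g ⋆ f) n
    ≡⟨ cong₂ _+_ (⋆-congˡ g (equation sf) n) (⋆-congˡ f (equation sg) n) ⟩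
  ((λ j → α * θ f j + β * f j + v j) ⋆ g) n + ((λ j → α * θ g j + γ * g j + w j) ⋆ f) n
    ≡⟨ cong₂ _+_ (expand β v f g n) (expand γ w g f n) ⟩
  (α * (θ f ⋆ g) n + β * (f ⋆ g) n + (v ⋆ g) n) + (α * (θ g ⋆ f) n + γ * (g ⋆ f) n + (w ⋆ f) n)
    ≡⟨ cong (λ x → (α * (θ f ⋆ g) n + β * (f ⋆ g) n + (v ⋆ g) n)
                   + (α * (θ g ⋆ f) n + γ * x + (w ⋆ f) n)) (⋆-comm g f n) ⟩
  (α * (θ f ⋆ g) n + β * (f ⋆ g) n + (v ⋆ g) n) + (α * (θ g ⋆ f) n + γ * (f ⋆ g) n + (w ⋆ f) n)
    ≡⟨ solve 8 (λ α β γ A B V C W → (α :* A :+ β :* B :+ V) :+ (α :* C :+ γ :* B :+ W)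
                                   := α :* (A :+ C) :+ (β :+ γ) :* B :+ (V :+ W))
         refl α β γ ((θ f ⋆ g) n) ((f ⋆ g) n) ((v ⋆ g) n) ((θ g ⋆ f) n) ((w ⋆ f) n) ⟩
  α * ((θ f ⋆ g) n + (θ g ⋆ f) n) + (β + γ) * (f ⋆ g) n + ((v ⋆ g) n + (w ⋆ f) n)
    ≡⟨ cong (λ x → α * x + (β + γ) * (f ⋆ g) n + ((v ⋆ g) n + (w ⋆ f) n)) (θ-⋆ f g n) ⟨
  α * θ (f ⋆ g) n + (β + γ) * (f ⋆ g) n + ((v ⋆ g) n + (w ⋆ f) n) ∎
  where
  expand : ∀ b u h k n →
           ((λ j → α * θ h j + b * h j + u j) ⋆ k) n ≡ α * (θ h ⋆ k) n + b * (h ⋆ k) n + (u ⋆ k) n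
  expand b u h k n = begin
    ((λ j → α * θ h j + b * h j + u j) ⋆ k) n
      ≡⟨ ⋆-distribʳ-+ (λ j → α * θ h j + b * h j) u k n ⟩
    ((λ j → α * θ h j + b * h j) ⋆ k) n + (u ⋆ k) n
      ≡⟨ cong (_+ (u ⋆ k) n) (⋆-distribʳ-+ (λ j → α * θ h j) (λ j → b * h j) k n) ⟩
    ((λ j → α * θ h j) ⋆ k) n + ((λ j → b * h j) ⋆ k) n + (u ⋆ k) n
      ≡⟨ cong₂ (λ x y → x + y + (u ⋆ k) n) (⋆-*ˡ α (θ h) k n) (⋆-*ˡ b h k n) ⟩
    α * (θ h ⋆ k) n + b * (h ⋆ k) n + (u ⋆ k) n ∎

toℚ-odd : ∀ n → toℚ (suc (2 ℕ.* n)) ≡ 1ℚ + toℚ 2 * toℚ n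
toℚ-odd n = trans (toℚ-suc (2 ℕ.* n)) (cong (1ℚ +_) (toℚ-* 2 n))

cbin-suc : ∀ n → toℚ (suc n) * cbin (suc n) ≡ toℚ 2 * toℚ (suc (2 ℕ.* n)) * cbin n
cbin-suc n = begin
  toℚ (suc n) * cbin (suc n)                          ≡⟨ toℚ-* (suc n) ((2 ℕ.* suc n) C suc n) ⟨
  toℚ (suc n ℕ.* ((2 ℕ.* suc n) C suc n))             ≡⟨ cong toℚ ([n+1]*[2n+2]C[n+1]≡2*[2n+1]*[2n]Cn n) ⟩
  toℚ (2 ℕ.* suc (2 ℕ.* n) ℕ.* ((2 ℕ.* n) C n))       ≡⟨ toℚ-* (2 ℕ.* suc (2 ℕ.* n)) ((2 ℕ.* n) C n) ⟩
  toℚ (2 ℕ.* suc (2 ℕ.* n)) * cbin n                  ≡⟨ cong (_* cbin n) (toℚ-* 2 (suc (2 ℕ.* n))) ⟩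
  toℚ 2 * toℚ (suc (2 ℕ.* n)) * cbin n                ∎

cbin-solution : IsSolution (toℚ 4) (toℚ 2) (λ _ → 0ℚ) cbin
cbin-solution = isSolution λ n → begin
  toℚ (suc n) * cbin (suc n)                ≡⟨ cbin-suc n ⟩
  toℚ 2 * toℚ (suc (2 ℕ.* n)) * cbin n      ≡⟨ cong (λ x → toℚ 2 * x * cbin n) (toℚ-odd n) ⟩
  toℚ 2 * (1ℚ + toℚ 2 * toℚ n) * cbin n
    ≡⟨ solve 2 (λ m c → con (toℚ 2) :* (con 1ℚ :+ con (toℚ 2) :* m) :* c
                        := con (toℚ 4) :* (m :* c) :+ con (toℚ 2) :* c :+ con 0ℚ) refl (toℚ n) (cbin n) ⟩
  toℚ 4 * (toℚ n * cbin n) + toℚ 2 * cbin n + 0ℚ ∎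

one : Series
one _ = 1ℚ

dilate4-one-solution : IsSolution (toℚ 4) (toℚ 4) (λ _ → 0ℚ) (dilate 4 one)
dilate4-one-solution = isSolution λ n → begin
  toℚ (suc n) * (toℚ (4 ℕ.* 4 ℕ.^ n) * 1ℚ)
    ≡⟨ cong₂ (λ x y → x * (y * 1ℚ)) (toℚ-suc n) (toℚ-* 4 (4 ℕ.^ n)) ⟩
  (1ℚ + toℚ n) * (toℚ 4 * toℚ (4 ℕ.^ n) * 1ℚ)
    ≡⟨ solve 2 (λ m p → (con 1ℚ :+ m) :* (con (toℚ 4) :* p :* con 1ℚ)
                        := con (toℚ 4) :* (m :* (p :* con 1ℚ)) :+ con (toℚ 4) :* (p :* con 1ℚ) :+ con 0ℚ)
         refl (toℚ n) (toℚ (4 ℕ.^ n)) ⟩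
  toℚ 4 * (toℚ n * dilate 4 one n) + toℚ 4 * dilate 4 one n + 0ℚ ∎

cbin⋆cbin≡4^n : ∀ n → (cbin ⋆ cbin) n ≡ dilate 4 one n
cbin⋆cbin≡4^n = solution-unique
  (IsSolution-⋆ cbin-solution cbin-solution) dilate4-one-solution
  (λ n → cong₂ _+_ (⋆-zeroˡ cbin n) (⋆-zeroˡ cbin n)) refl

cbin·O : Series
cbin·O j = cbin j * O j

cbin·O-solution : IsSolution (toℚ 4) (toℚ 2) (λ n → toℚ 2 * cbin n) cbin·O
cbin·O-solution = isSolution λ n → begin
  toℚ (suc n) * (cbin (suc n) * (O n + r n))
    ≡⟨ *-assoc (toℚ (suc n)) (cbin (suc n)) (O n + r n) ⟨
  toℚ (suc n) * cbin (suc n) * (O n + r n)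
    ≡⟨ cong (_* (O n + r n)) (cbin-suc n) ⟩
  toℚ 2 * t n * cbin n * (O n + r n)
    ≡⟨ solve 4 (λ t c o r → con (toℚ 2) :* t :* c :* (o :+ r)
                            := con (toℚ 2) :* t :* (c :* o) :+ con (toℚ 2) :* c :* (t :* r))
         refl (t n) (cbin n) (O n) (r n) ⟩
  toℚ 2 * t n * cbin·O n + toℚ 2 * cbin n * (t n * r n)
    ≡⟨ cong₂ (λ x y → toℚ 2 * x * cbin·O n + toℚ 2 * cbin n * y) (toℚ-odd n) (toℚ-*-recip (2 ℕ.* n)) ⟩
  toℚ 2 * (1ℚ + toℚ 2 * toℚ n) * cbin·O n + toℚ 2 * cbin n * 1ℚ
    ≡⟨ solve 3 (λ m b c → con (toℚ 2) :* (con 1ℚ :+ con (toℚ 2) :* m) :* b :+ con (toℚ 2) :* c :* con 1ℚ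
                          := con (toℚ 4) :* (m :* b) :+ con (toℚ 2) :* b :+ con (toℚ 2) :* c)
         refl (toℚ n) (cbin·O n) (cbin n) ⟩
  toℚ 4 * (toℚ n * cbin·O n) + toℚ 2 * cbin·O n + toℚ 2 * cbin n ∎
  where
  t r : ℕ → ℚ
  t n = toℚ (suc (2 ℕ.* n))
  r n = recip (suc (2 ℕ.* n))

-- The coefficients of ½ log(1/(1 − 4x)); the constant term is 0 because recip 0 = 0.
halfLog : Series
halfLog = dilate 4 (λ j → ½ * recip j)

halfLog-solution : IsSolution (toℚ 4) 0ℚ (scalar (toℚ 2)) halfLog
halfLog-solution = isSolution λ where
  zero    → refl
  (suc k) → begin
    toℚ (suc (suc k)) * (toℚ (4 ℕ.* 4 ℕ.^ suc k) * (½ * recip (suc (suc k))))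
      ≡⟨ cong (λ x → toℚ (suc (suc k)) * (x * (½ * recip (suc (suc k))))) (toℚ-* 4 (4 ℕ.^ suc k)) ⟩
    toℚ (suc (suc k)) * (toℚ 4 * toℚ (4 ℕ.^ suc k) * (½ * recip (suc (suc k))))
      ≡⟨ solve 3 (λ t r p → t :* (con (toℚ 4) :* p :* (con ½ :* r)) := t :* r :* (con (toℚ 4) :* p :* con ½))
           refl (toℚ (suc (suc k))) (recip (suc (suc k))) (toℚ (4 ℕ.^ suc k)) ⟩
    toℚ (suc (suc k)) * recip (suc (suc k)) * (toℚ 4 * toℚ (4 ℕ.^ suc k) * ½)
      ≡⟨ cong (_* (toℚ 4 * toℚ (4 ℕ.^ suc k) * ½)) (trans (toℚ-*-recip (suc k)) (sym (toℚ-*-recip k))) ⟩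
    toℚ (suc k) * recip (suc k) * (toℚ 4 * toℚ (4 ℕ.^ suc k) * ½)
      ≡⟨ solve 3 (λ t r p → t :* r :* (con (toℚ 4) :* p :* con ½)
                            := con (toℚ 4) :* (t :* (p :* (con ½ :* r))) :+ con 0ℚ :* (p :* (con ½ :* r)) :+ con 0ℚ)
           refl (toℚ (suc k)) (recip (suc k)) (toℚ (4 ℕ.^ suc k)) ⟩
    toℚ 4 * θ halfLog (suc k) + 0ℚ * halfLog (suc k) + 0ℚ ∎

cbin·O≡cbin⋆halfLog : ∀ n → cbin·O n ≡ (cbin ⋆ halfLog) n
cbin·O≡cbin⋆halfLog = solution-unique cbin·O-solution (IsSolution-⋆ cbin-solution halfLog-solution)
  (λ n → sym (trans (cong₂ _+_ (⋆-zeroˡ halfLog n) (⋆-scalarˡ (toℚ 2) cbin n))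
                    (+-identityˡ (toℚ 2 * cbin n))))
  refl

one⋆[recip⋆recip] : ∀ n → (one ⋆ (recip ⋆ recip)) n ≡ sum1 n (λ j → H (n ∸ j) * recip j)
one⋆[recip⋆recip] n = begin
  (one ⋆ (recip ⋆ recip)) n     ≡⟨ ⋆-assoc one recip recip n ⟨
  ((one ⋆ recip) ⋆ recip) n     ≡⟨ ⋆-congˡ recip one⋆recip≡H n ⟩
  (H ⋆ recip) n                 ≡⟨ ⋆-recip H n ⟩
  sum1 n (λ j → H (n ∸ j) * recip j) ∎
  where
  one⋆recip≡H : ∀ m → (one ⋆ recip) m ≡ H m
  one⋆recip≡H m = trans (⋆-recip one m) (sum1-cong m (λ j → *-identityˡ (recip j)))

dilate4-one⋆[halfLog⋆halfLog] : ∀ n →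
  (dilate 4 one ⋆ (halfLog ⋆ halfLog)) n ≡ pow4m1 n * sum1 n (λ j → H (n ∸ j) * recip j)
dilate4-one⋆[halfLog⋆halfLog] n = begin
  (dilate 4 one ⋆ (halfLog ⋆ halfLog)) n
    ≡⟨ ⋆-congʳ (dilate 4 one) (⋆-dilate 4 h h) n ⟩
  (dilate 4 one ⋆ dilate 4 (h ⋆ h)) n
    ≡⟨ ⋆-dilate 4 one (h ⋆ h) n ⟩
  toℚ (4 ℕ.^ n) * (one ⋆ (h ⋆ h)) n
    ≡⟨ cong (toℚ (4 ℕ.^ n) *_) (⋆-congʳ one h⋆h n) ⟩
  toℚ (4 ℕ.^ n) * (one ⋆ (λ m → ¼ * (recip ⋆ recip) m)) n
    ≡⟨ cong (toℚ (4 ℕ.^ n) *_) (⋆-*ʳ ¼ one (recip ⋆ recip) n) ⟩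
  toℚ (4 ℕ.^ n) * (¼ * (one ⋆ (recip ⋆ recip)) n)
    ≡⟨ cong (λ x → toℚ (4 ℕ.^ n) * (¼ * x)) (one⋆[recip⋆recip] n) ⟩
  toℚ (4 ℕ.^ n) * (¼ * S)
    ≡⟨ solve 3 (λ p q s → p :* (q :* s) := q :* p :* s) refl (toℚ (4 ℕ.^ n)) ¼ S ⟩
  pow4m1 n * S ∎
  where
  h : Series
  h j = ½ * recip j
  ¼ : ℚ
  ¼ = ½ * ½
  S : ℚ
  S = sum1 n (λ j → H (n ∸ j) * recip j)
  h⋆h : ∀ m → (h ⋆ h) m ≡ ¼ * (recip ⋆ recip) m
  h⋆h m = trans (⋆-*ˡ ½ recip h m)
                (trans (cong (½ *_) (⋆-*ʳ ½ recip recip m)) (sym (*-assoc ½ ½ ((recip ⋆ recip) m))))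

corollary4 : (n : ℕ) →
    sum0 n (λ j → cbin j * cbin (n ∸ j) * O j * O (n ∸ j))
      ≡ pow4m1 n * sum1 n (λ j → H (n ∸ j) * recip j)
corollary4 n = begin
  sum0 n (λ j → cbin j * cbin (n ∸ j) * O j * O (n ∸ j))
    ≡⟨ sum0-cong n (λ j → solve 4 (λ a b x y → a :* b :* x :* y := a :* x :* (b :* y)) refl
                            (cbin j) (cbin (n ∸ j)) (O j) (O (n ∸ j))) ⟩
  (cbin·O ⋆ cbin·O) n                           ≡⟨ ⋆-cong cbin·O≡cbin⋆halfLog cbin·O≡cbin⋆halfLog n ⟩
  ((cbin ⋆ halfLog) ⋆ (cbin ⋆ halfLog)) n       ≡⟨ ⋆-interchange cbin halfLog cbin halfLog n ⟩
  ((cbin ⋆ cbin) ⋆ (halfLog ⋆ halfLog)) n       ≡⟨ ⋆-congˡ (halfLog ⋆ halfLog) cbin⋆cbin≡4^n n ⟩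
  (dilate 4 one ⋆ (halfLog ⋆ halfLog)) n        ≡⟨ dilate4-one⋆[halfLog⋆halfLog] n ⟩
  pow4m1 n * sum1 n (λ j → H (n ∸ j) * recip j) ∎
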